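{- Let $\mu\in(1,2)$. If there exists a positive integer $n$ such that $f^n(1/2)=1/2$, then $|\mathcal{T}_{n'}|\le 2n$ for every $n'\ge n$.
   Context: The tent map is $f(x)=\mu x$ for $x\le1/2$ and $f(x)=\mu(1-x)$ for $x\ge1/2$ on $[0,1]$; $f^n$ is its $n$-fold iterate, $x_i=f^i(x)$. The tent code $\gamma^n(x)=b_1\cdots b_n$ of $x\in[0,1)$: $b_1=0$ if $x<1/2$, $b_1=1$ if $x\ge1/2$; for $i\ge1$, $b_{i+1}=b_i$ if $x_i<1/2$, $b_{i+1}=1-b_i$ if $x_i>1/2$, $b_{i+1}=1$ if $x_i=1/2$. $\mathcal{L}_n=\{\gamma^n(x):x\in[0,1)\}$. For $\mathbf{b}\in\mathcal{L}_n$, $S_n(\mathbf{b})=\{x\in[0,1):\gamma^n(x)=\mathbf{b}\}$, the segment-type $T(\mathbf{b})=\{f^n(x):x\in S_n(\mathbf{b})\}$, and $\mathcal{T}_n=\{T(\mathbf{b}):\mathbf{b}\in\mathcal{L}_n\}$ (a set of intervals). -}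

module Defs where

open import Data.Nat using (ℕ; zero; suc)
open import Data.Bool using (Bool; true; false; not)
open import Data.Fin using (Fin; toℕ)
open import Data.Vec using (Vec; tabulate)
open import Data.List using (List; length)
open import Data.List.Relation.Unary.All using (All)
open import Data.List.Relation.Unary.Any using (Any)
open import Data.Product using (Σ; ∃; _×_; _,_)
open import Data.Sum using (_⊎_)
open import Relation.Nullary using (¬_)
open import Relation.Binary using (Trichotomous; Tri; tri<; tri≈; tri>)
open import Relation.Binary.PropositionalEquality using (_≡_; _≢_)
import Data.Nat as N

-- The real numbers, axiomatised as a Dedekind-complete ordered field
-- (all models are isomorphic to ℝ).
record RealField : Set₁ where
  infixl 6 _+_
  infixl 7 _*_
  infix 4 _<_
  field
    R : Set
    0r 1r half : R
    _+_ _*_ : R → R → R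
    -_ : R → R
    _<_ : R → R → Set
    +-assoc : ∀ x y z → (x + y) + z ≡ x + (y + z)
    +-comm : ∀ x y → x + y ≡ y + x
    +-identityˡ : ∀ x → 0r + x ≡ x
    -‿inverseˡ : ∀ x → (- x) + x ≡ 0r
    *-assoc : ∀ x y z → (x * y) * z ≡ x * (y * z)
    *-comm : ∀ x y → x * y ≡ y * x
    *-identityˡ : ∀ x → 1r * x ≡ x
    distribˡ : ∀ x y z → x * (y + z) ≡ x * y + x * z
    0≢1 : 0r ≢ 1r
    *-inverse : ∀ x → x ≢ 0r → ∃ λ y → x * y ≡ 1r
    half-def : half + half ≡ 1r
    compare : Trichotomous _≡_ _<_
    <-trans : ∀ {x y z} → x < y → y < z → x < z
    +-mono-< : ∀ {x y} z → x < y → x + z < y + z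
    *-pos : ∀ {x y} → 0r < x → 0r < y → 0r < x * y
    complete : (P : R → Set) → ∃ P → (∃ λ u → ∀ x → P x → x < u ⊎ x ≡ u) →
      ∃ λ s → (∀ x → P x → x < s ⊎ x ≡ s) ×
              (∀ u → (∀ x → P x → x < u ⊎ x ≡ u) → s < u ⊎ s ≡ u)

module Tent (ℝ : RealField) (μ : RealField.R ℝ) where
  open RealField ℝ

  _-_ : R → R → R
  x - y = x + (- y)

  f : R → R
  f x with compare x half
  ... | tri< _ _ _ = μ * x
  ... | tri≈ _ _ _ = μ * x
  ... | tri> _ _ _ = μ * (1r - x)

  iter : ℕ → R → R
  iter zero x = x
  iter (suc k) x = f (iter k x)

  step : Bool → R → Bool
  step b y with compare y half
  ... | tri< _ _ _ = b
  ... | tri≈ _ _ _ = true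
  ... | tri> _ _ _ = not b

  -- bit i x = b_{i+1} (0-indexed)
  bit : ℕ → R → Bool
  bit zero x with compare x half
  ... | tri< _ _ _ = false
  ... | tri≈ _ _ _ = true
  ... | tri> _ _ _ = true
  bit (suc i) x = step (bit i x) (iter (suc i) x)

  γ : (n : ℕ) → R → Vec Bool n
  γ n x = tabulate (λ (i : Fin n) → bit (toℕ i) x)

  InDom : R → Set
  InDom x = (0r < x ⊎ 0r ≡ x) × x < 1r

  S : (n : ℕ) → Vec Bool n → R → Set
  S n b x = InDom x × γ n x ≡ b

  InL : (n : ℕ) → Vec Bool n → Set
  InL n b = ∃ (S n b)

  T : (n : ℕ) → Vec Bool n → R → Set
  T n b y = ∃ λ x → S n b x × iter n x ≡ y

  SameType : (n : ℕ) → Vec Bool n → Vec Bool n → Set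
  SameType n b b' = ∀ y → (T n b y → T n b' y) × (T n b' y → T n b y)

  -- |𝓣_n| ≤ k : some list of at most k codes whose segment-types
  -- exhaust 𝓣_n = {T(b) : b ∈ 𝓛_n}
  CardTypes≤ : ℕ → ℕ → Set
  CardTypes≤ n k = ∃ λ (L : List (Vec Bool n)) →
    length L N.≤ k × All (InL n) L ×
    (∀ b → InL n b → Any (λ b' → SameType n b b') L)

-- For a code b of length n′, f^n′ maps the points with code b monotonically onto an interval: the
-- image of [0,1) under the branch of f selected by each bit in turn, with the last bit recording
-- which end is closed. Let c k = f^k(½), and let level k of the Hofbauer tower have ends c k and
-- p k, where p 0 = 0 and p (k+1) is c 1 if ½ lies strictly between c k and p k, and f (p k)
-- otherwise. Each level k ≥ 1 is anchored: p k is 0, or the critical value c j of an earlier level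
-- containing level k. Hence the nonempty children of level k are level k+1 and, when ½ cuts
-- level k, the interval between c 1 and f (p k), which is again a level ≤ k. If c n = ½, the image
-- of level n is an earlier level too, so every nonempty interval produced from [0,1) is one of the
-- levels 1, …, n, and with the two choices of closed end there are at most 2n segment types;
-- representative codes are found by searching all codes of length n′.

module Submission where

open import Defs
open import Level using (0ℓ)
open import Algebra.Bundles using (CommutativeRing)
open import Algebra.Structures using (IsAbelianGroup)
open import Algebra.Consequences.Propositional
  using (comm∧idˡ⇒id; comm∧invˡ⇒inv; comm∧distrˡ⇒distrʳ)
import Algebra.Properties.Ring as RingProperties
open import Data.Bool as Bool using (Bool; true; false; not; if_then_else_; _xor_)
open import Data.Bool.Properties using (not-involutive)
open import Data.Nat as ℕ using (ℕ; zero; suc; z≤n; s≤s)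
import Data.Nat.Properties as ℕₚ
open import Data.Fin using (Fin; toℕ)
open import Data.List as List using (List; []; _∷_; _++_; length)
open import Data.List.Relation.Unary.Any as Any using (Any; here; there; any?; satisfied)
import Data.List.Relation.Unary.Any.Properties as Anyₚ
import Data.List.Relation.Unary.All as All
import Data.List.Relation.Unary.All.Properties as Allₚ
open import Data.List.Properties using (length-mapMaybe)
open import Data.Maybe using (Maybe; just; nothing)
import Data.Maybe.Relation.Unary.All as Maybe
import Data.Maybe.Relation.Unary.Any as Maybe
open import Data.List.Membership.Propositional using (lose) renaming (_∈_ to _∈ₗ_)
open import Data.List.Membership.Propositional.Properties using (∈-map⁺; ∈-++⁺ˡ; ∈-++⁺ʳ)
open import Data.Vec using (Vec; []; _∷_; tabulate)
open import Data.Vec.Properties using (tabulate-cong)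
open import Data.Empty using (⊥; ⊥-elim)
open import Data.Product using (∃; _×_; _,_; proj₁; proj₂; uncurry; swap)
open import Data.Product.Properties using (≡-dec)
open import Data.Sum as Sum using (_⊎_; inj₁; inj₂)
open import Function using (_∘_)
open import Relation.Binary using (tri<; tri≈; tri>; Decidable)
open import Relation.Binary.Definitions using (DecidableEquality)
open import Relation.Binary.Consequences using (tri⇒dec≈; tri⇒dec<)
open import Relation.Unary using (Pred; _∈_; _⊆_)
open import Relation.Nullary using (¬_; Dec; yes; no)
open import Relation.Nullary.Decidable using (_×-dec_; _⊎-dec_)
open import Relation.Binary.PropositionalEquality
  using (_≡_; _≢_; refl; sym; trans; cong; cong₂; subst; subst₂; isEquivalence; module ≡-Reasoning)

module _ {a} {A : Set a} where

  infix 4 _≐_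
  _≐_ : A × A → A × A → Set a
  u ≐ v = u ≡ v ⊎ u ≡ swap v

  ≐-sym : ∀ {u v} → u ≐ v → v ≐ u
  ≐-sym (inj₁ refl) = inj₁ refl
  ≐-sym (inj₂ refl) = inj₂ refl

  ≐-trans : ∀ {u v w} → u ≐ v → v ≐ w → u ≐ w
  ≐-trans (inj₁ refl) v≐w = v≐w
  ≐-trans (inj₂ refl) (inj₁ refl) = inj₂ refl
  ≐-trans (inj₂ refl) (inj₂ refl) = inj₁ refl

  ≐-swap : ∀ {u v} → u ≐ v → u ≐ swap v
  ≐-swap (inj₁ refl) = inj₂ refl
  ≐-swap (inj₂ refl) = inj₁ refl

  ≐-dec : DecidableEquality A → ∀ u v → Dec (u ≐ v)
  ≐-dec _≟_ u v = ≡-dec _≟_ _≟_ u v ⊎-dec ≡-dec _≟_ _≟_ u (swap v)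

allVecs : ∀ m → List (Vec Bool m)
allVecs zero = [] ∷ []
allVecs (suc m) = List.map (false ∷_) (allVecs m) ++ List.map (true ∷_) (allVecs m)

∈-allVecs : ∀ {m} (v : Vec Bool m) → v ∈ₗ allVecs m
∈-allVecs [] = here refl
∈-allVecs (false ∷ v) = ∈-++⁺ˡ (∈-map⁺ (false ∷_) (∈-allVecs v))
∈-allVecs {suc m} (true ∷ v) =
  ∈-++⁺ʳ (List.map (false ∷_) (allVecs m)) (∈-map⁺ (true ∷_) (∈-allVecs v))

levelsAndBits : ℕ → List (ℕ × Bool)
levelsAndBits zero = []
levelsAndBits (suc k) = (suc k , false) ∷ (suc k , true) ∷ levelsAndBits k

length-levelsAndBits : ∀ k → length (levelsAndBits k) ≡ 2 ℕ.* k
length-levelsAndBits zero = refl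
length-levelsAndBits (suc k) = trans (cong (2 ℕ.+_) (length-levelsAndBits k)) (sym (ℕₚ.*-suc 2 k))

∈-levelsAndBits : ∀ {j k} b → 1 ℕ.≤ j → j ℕ.≤ k → (j , b) ∈ₗ levelsAndBits k
∈-levelsAndBits {k = zero} b (s≤s _) ()
∈-levelsAndBits {k = suc k} b 1≤j j≤k with ℕₚ.m≤n⇒m<n∨m≡n j≤k | b
... | inj₂ refl | false = here refl
... | inj₂ refl | true = there (here refl)
... | inj₁ j<k | b′ = there (there (∈-levelsAndBits b′ 1≤j (ℕₚ.≤-pred j<k)))

module OrderedField (ℝ : RealField) where
  open RealField ℝ public

  +-isAbelianGroup : IsAbelianGroup _≡_ _+_ 0r -_
  +-isAbelianGroup = record
    { isGroup = record
      { isMonoid = record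
        { isSemigroup = record
          { isMagma = record { isEquivalence = isEquivalence ; ∙-cong = cong₂ _+_ }
          ; assoc = +-assoc }
        ; identity = comm∧idˡ⇒id +-comm +-identityˡ }
      ; inverse = comm∧invˡ⇒inv +-comm -‿inverseˡ
      ; ⁻¹-cong = cong -_ }
    ; comm = +-comm }

  commutativeRing : CommutativeRing 0ℓ 0ℓ
  commutativeRing = record
    { isCommutativeRing = record
      { isRing = record
        { +-isAbelianGroup = +-isAbelianGroup
        ; *-cong = cong₂ _*_
        ; *-assoc = *-assoc
        ; *-identity = comm∧idˡ⇒id *-comm *-identityˡ
        ; distrib = distribˡ , comm∧distrˡ⇒distrʳ *-comm distribˡ }
      ; *-comm = *-comm } }

  open CommutativeRing commutativeRing public
    using (_-_; +-identityʳ; *-identityʳ; -‿inverseʳ; zeroʳ)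
  open RingProperties (CommutativeRing.ring commutativeRing) public
    using (-0#≈0#; -‿involutive; -‿anti-homo-+; -‿distribˡ-*; x[y-z]≈xy-xz)
  open ≡-Reasoning

  infix 4 _≤_
  _≤_ : R → R → Set
  x ≤ y = x < y ⊎ x ≡ y

  <-irrefl : ∀ {x} → x < x → ⊥
  <-irrefl {x} x<x with compare x x
  ... | tri< _ x≢x _ = x≢x refl
  ... | tri≈ x≮x _ _ = x≮x x<x
  ... | tri> _ x≢x _ = x≢x refl

  <⇒≢ : ∀ {x y} → x < y → x ≢ y
  <⇒≢ x<x refl = <-irrefl x<x

  <-asym : ∀ {x y} → x < y → y < x → ⊥
  <-asym x<y y<x = <-irrefl (<-trans x<y y<x)

  ≤-refl : ∀ {x} → x ≤ x
  ≤-refl = inj₂ refl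

  <-≤-trans : ∀ {x y z} → x < y → y ≤ z → x < z
  <-≤-trans x<y (inj₁ y<z) = <-trans x<y y<z
  <-≤-trans x<y (inj₂ refl) = x<y

  ≤-<-trans : ∀ {x y z} → x ≤ y → y < z → x < z
  ≤-<-trans (inj₁ x<y) y<z = <-trans x<y y<z
  ≤-<-trans (inj₂ refl) y<z = y<z

  ≤-trans : ∀ {x y z} → x ≤ y → y ≤ z → x ≤ z
  ≤-trans (inj₁ x<y) y≤z = inj₁ (<-≤-trans x<y y≤z)
  ≤-trans (inj₂ refl) y≤z = y≤z

  ≤⇒≯ : ∀ {x y} → x ≤ y → y < x → ⊥
  ≤⇒≯ x≤y y<x = <-irrefl (≤-<-trans x≤y y<x)

  ≤-antisym : ∀ {x y} → x ≤ y → y ≤ x → x ≡ y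
  ≤-antisym (inj₂ x≡y) _ = x≡y
  ≤-antisym (inj₁ x<y) y≤x = ⊥-elim (≤⇒≯ y≤x x<y)

  <-≤-total : ∀ x y → x < y ⊎ y ≤ x
  <-≤-total x y with compare x y
  ... | tri< x<y _ _ = inj₁ x<y
  ... | tri≈ _ x≡y _ = inj₂ (inj₂ (sym x≡y))
  ... | tri> _ _ y<x = inj₂ (inj₁ y<x)

  +-monoʳ-< : ∀ z {x y} → x < y → z + x < z + y
  +-monoʳ-< z {x} {y} x<y = subst₂ _<_ (+-comm x z) (+-comm y z) (+-mono-< z x<y)

  x+[-x+y]≡y : ∀ x y → x + (- x + y) ≡ y
  x+[-x+y]≡y x y = begin
    x + (- x + y)  ≡⟨ +-assoc x (- x) y ⟨
    (x - x) + y    ≡⟨ cong (_+ y) (-‿inverseʳ x) ⟩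
    0r + y         ≡⟨ +-identityˡ y ⟩
    y              ∎

  x-[x-y]≡y : ∀ x y → x - (x - y) ≡ y
  x-[x-y]≡y x y = begin
    x - (x - y)     ≡⟨ cong (x +_) (-‿anti-homo-+ x (- y)) ⟩
    x + (- - y - x) ≡⟨ cong (λ t → x + (t - x)) (-‿involutive y) ⟩
    x + (y - x)     ≡⟨ cong (x +_) (+-comm y (- x)) ⟩
    x + (- x + y)   ≡⟨ x+[-x+y]≡y x y ⟩
    y               ∎

  neg-mono-< : ∀ {x y} → x < y → - y < - x
  neg-mono-< {x} {y} x<y = subst₂ _<_ (x+[-x+y]≡y x (- y)) eq (+-mono-< (- x - y) x<y)
    where
    eq : y + (- x - y) ≡ - x
    eq = trans (cong (y +_) (+-comm (- x) (- y))) (x+[-x+y]≡y y (- x))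

  x<y⇒0<y-x : ∀ {x y} → x < y → 0r < y - x
  x<y⇒0<y-x {x} {y} x<y = subst (_< y - x) (-‿inverseʳ x) (+-mono-< (- x) x<y)

  0<y-x⇒x<y : ∀ {x y} → 0r < y - x → x < y
  0<y-x⇒x<y {x} {y} 0<y-x = subst₂ _<_ (+-identityˡ x) eq (+-mono-< x 0<y-x)
    where
    eq : (y - x) + x ≡ y
    eq = trans (+-assoc y (- x) x) (trans (cong (y +_) (-‿inverseˡ x)) (+-identityʳ y))

  *-monoˡ-< : ∀ {c x y} → 0r < c → x < y → c * x < c * y
  *-monoˡ-< {c} {x} {y} 0<c x<y =
    0<y-x⇒x<y (subst (0r <_) (x[y-z]≈xy-xz c y x) (*-pos 0<c (x<y⇒0<y-x x<y)))

  0<1 : 0r < 1r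
  0<1 with compare 0r 1r
  ... | tri< 0<1 _ _ = 0<1
  ... | tri≈ _ 0≡1 _ = ⊥-elim (0≢1 0≡1)
  ... | tri> _ _ 1<0 = ⊥-elim (<-asym 1<0 (subst (0r <_) [-1][-1]≡1 (*-pos 0<-1 0<-1)))
    where
    0<-1 : 0r < - 1r
    0<-1 = subst (_< - 1r) -0#≈0# (neg-mono-< 1<0)
    [-1][-1]≡1 : - 1r * - 1r ≡ 1r
    [-1][-1]≡1 = begin
      - 1r * - 1r    ≡⟨ -‿distribˡ-* 1r (- 1r) ⟨
      - (1r * - 1r)  ≡⟨ cong -_ (*-identityˡ (- 1r)) ⟩
      - - 1r         ≡⟨ -‿involutive 1r ⟩
      1r             ∎

  1-½≡½ : 1r - half ≡ half
  1-½≡½ = begin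
    1r - half             ≡⟨ cong (_- half) half-def ⟨
    (half + half) - half  ≡⟨ +-assoc half half (- half) ⟩
    half + (half - half)  ≡⟨ cong (half +_) (-‿inverseʳ half) ⟩
    half + 0r             ≡⟨ +-identityʳ half ⟩
    half                  ∎

  0<½ : 0r < half
  0<½ with compare 0r half
  ... | tri< 0<½ _ _ = 0<½
  ... | tri≈ _ 0≡½ _ =
    ⊥-elim (0≢1 (trans (sym (+-identityˡ 0r)) (trans (cong₂ _+_ 0≡½ 0≡½) half-def)))
  ... | tri> _ _ ½<0 = ⊥-elim (<-asym 0<1 (<-trans 1<½ ½<0))
    where
    1<½ : 1r < half
    1<½ = subst₂ _<_ half-def (+-identityˡ half) (+-mono-< half ½<0)

  ½<1 : half < 1r
  ½<1 = 0<y-x⇒x<y (subst (0r <_) (sym 1-½≡½) 0<½)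

  infix 4 _⊏[_]_
  _⊏[_]_ : R → Bool → R → Set
  x ⊏[ false ] y = x ≤ y
  x ⊏[ true ] y = x < y

  ⊏⇒≤ : ∀ b {x y} → x ⊏[ b ] y → x ≤ y
  ⊏⇒≤ false x≤y = x≤y
  ⊏⇒≤ true x<y = inj₁ x<y

  ⊏-≤-trans : ∀ b {x y z} → x ⊏[ b ] y → y ≤ z → x ⊏[ b ] z
  ⊏-≤-trans false = ≤-trans
  ⊏-≤-trans true = <-≤-trans

  ≤-⊏-trans : ∀ b {x y z} → x ≤ y → y ⊏[ b ] z → x ⊏[ b ] z
  ≤-⊏-trans false = ≤-trans
  ≤-⊏-trans true = ≤-<-trans

  ⊏-total : ∀ b x y → x ⊏[ b ] y ⊎ y ⊏[ not b ] x
  ⊏-total false x y with <-≤-total y x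
  ... | inj₁ y<x = inj₂ y<x
  ... | inj₂ x≤y = inj₁ x≤y
  ⊏-total true x y = <-≤-total x y

  ⊏-contra : ∀ b {x y} → x ⊏[ b ] y → y ⊏[ not b ] x → ⊥
  ⊏-contra false x≤y y<x = ≤⇒≯ x≤y y<x
  ⊏-contra true x<y y≤x = ≤⇒≯ y≤x x<y

  ⊏-either-strict : ∀ b {x y z} → x ⊏[ b ] y → y ⊏[ not b ] z → x < z
  ⊏-either-strict false x≤y y<z = ≤-<-trans x≤y y<z
  ⊏-either-strict true x<y y≤z = <-≤-trans x<y y≤z

  Hull : R → R → Pred R 0ℓ
  Hull a b y = (a ≤ y × y ≤ b) ⊎ (b ≤ y × y ≤ a)

  hull-left : ∀ a b → a ∈ Hull a b
  hull-left a b with <-≤-total a b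
  ... | inj₁ a<b = inj₁ (≤-refl , inj₁ a<b)
  ... | inj₂ b≤a = inj₂ (b≤a , ≤-refl)

  hull-bounded : ∀ {a b y z} → y ∈ Hull a b → a ≤ z → b ≤ z → y ≤ z
  hull-bounded (inj₁ (_ , y≤b)) _ b≤z = ≤-trans y≤b b≤z
  hull-bounded (inj₂ (_ , y≤a)) a≤z _ = ≤-trans y≤a a≤z

  hull-bounded⁻ : ∀ {a b y z} → y ∈ Hull a b → z ≤ a → z ≤ b → z ≤ y
  hull-bounded⁻ (inj₁ (a≤y , _)) z≤a _ = ≤-trans z≤a a≤y
  hull-bounded⁻ (inj₂ (b≤y , _)) _ z≤b = ≤-trans z≤b b≤y

  hull-ordered : ∀ {u v x} → u ≤ v → x ∈ Hull u v → u ≤ x × x ≤ v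
  hull-ordered _ (inj₁ bounds) = bounds
  hull-ordered u≤v (inj₂ (v≤x , x≤u)) = ≤-trans u≤v v≤x , ≤-trans x≤u u≤v

  hull-convex-≤ : ∀ {u v a b y} → u ≤ v → a ∈ Hull u v → b ∈ Hull u v → y ∈ Hull a b → u ≤ y × y ≤ v
  hull-convex-≤ u≤v a∈ b∈ y∈ =
    let u≤a , a≤v = hull-ordered u≤v a∈
        u≤b , b≤v = hull-ordered u≤v b∈
    in hull-bounded⁻ y∈ u≤a u≤b , hull-bounded y∈ a≤v b≤v

  hull-convex : ∀ {u v a b} → a ∈ Hull u v → b ∈ Hull u v → Hull a b ⊆ Hull u v
  hull-convex {u} {v} a∈ b∈ y∈ with <-≤-total v u
  ... | inj₂ u≤v = inj₁ (hull-convex-≤ u≤v a∈ b∈ y∈)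
  ... | inj₁ v<u = inj₂ (hull-convex-≤ (inj₁ v<u) (Sum.swap a∈) (Sum.swap b∈) y∈)

  module _ {g : R → R} (g-inc : ∀ {x y} → x < y → g x < g y) where

    increasing-⊏ : ∀ b {x y} → x ⊏[ b ] y → g x ⊏[ b ] g y
    increasing-⊏ false (inj₁ x<y) = inj₁ (g-inc x<y)
    increasing-⊏ false (inj₂ refl) = ≤-refl
    increasing-⊏ true x<y = g-inc x<y

    increasing-⊏⁻ : ∀ b {x y} → g x ⊏[ b ] g y → x ⊏[ b ] y
    increasing-⊏⁻ b {x} {y} gx⊏gy with ⊏-total b x y
    ... | inj₁ x⊏y = x⊏y
    ... | inj₂ y⊏x = ⊥-elim (⊏-contra b gx⊏gy (increasing-⊏ (not b) y⊏x))

    increasing-hull : ∀ {a b y} → y ∈ Hull a b → g y ∈ Hull (g a) (g b)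
    increasing-hull (inj₁ (a≤y , y≤b)) = inj₁ (increasing-⊏ false a≤y , increasing-⊏ false y≤b)
    increasing-hull (inj₂ (b≤y , y≤a)) = inj₂ (increasing-⊏ false b≤y , increasing-⊏ false y≤a)

  module _ {g : R → R} (g-dec : ∀ {x y} → x < y → g y < g x) where

    decreasing-⊏ : ∀ b {x y} → x ⊏[ b ] y → g y ⊏[ b ] g x
    decreasing-⊏ false (inj₁ x<y) = inj₁ (g-dec x<y)
    decreasing-⊏ false (inj₂ refl) = ≤-refl
    decreasing-⊏ true x<y = g-dec x<y

    decreasing-⊏⁻ : ∀ b {x y} → g y ⊏[ b ] g x → x ⊏[ b ] y
    decreasing-⊏⁻ b {x} {y} gy⊏gx with ⊏-total b x y
    ... | inj₁ x⊏y = x⊏y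
    ... | inj₂ y⊏x = ⊥-elim (⊏-contra b gy⊏gx (decreasing-⊏ (not b) y⊏x))

    decreasing-hull : ∀ {a b y} → y ∈ Hull a b → g y ∈ Hull (g a) (g b)
    decreasing-hull (inj₁ (a≤y , y≤b)) = inj₂ (decreasing-⊏ false y≤b , decreasing-⊏ false a≤y)
    decreasing-hull (inj₂ (b≤y , y≤a)) = inj₁ (decreasing-⊏ false y≤a , decreasing-⊏ false b≤y)

  _⊓_ _⊔_ : R → R → R
  x ⊓ y with <-≤-total x y
  ... | inj₁ _ = x
  ... | inj₂ _ = y
  x ⊔ y with <-≤-total y x
  ... | inj₁ _ = x
  ... | inj₂ _ = y

  x≤y⇒x⊓y≡x : ∀ {x y} → x ≤ y → x ⊓ y ≡ x
  x≤y⇒x⊓y≡x {x} {y} x≤y with <-≤-total x y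
  ... | inj₁ _ = refl
  ... | inj₂ y≤x = ≤-antisym y≤x x≤y

  y≤x⇒x⊓y≡y : ∀ {x y} → y ≤ x → x ⊓ y ≡ y
  y≤x⇒x⊓y≡y {x} {y} y≤x with <-≤-total x y
  ... | inj₁ x<y = ⊥-elim (≤⇒≯ y≤x x<y)
  ... | inj₂ _ = refl

  x≤y⇒x⊔y≡y : ∀ {x y} → x ≤ y → x ⊔ y ≡ y
  x≤y⇒x⊔y≡y {x} {y} x≤y with <-≤-total y x
  ... | inj₁ y<x = ⊥-elim (≤⇒≯ x≤y y<x)
  ... | inj₂ _ = refl

  y≤x⇒x⊔y≡x : ∀ {x y} → y ≤ x → x ⊔ y ≡ x
  y≤x⇒x⊔y≡x {x} {y} y≤x with <-≤-total y x
  ... | inj₁ _ = refl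
  ... | inj₂ x≤y = ≤-antisym y≤x x≤y

  ⊓-glb : ∀ b {x y z} → z ⊏[ b ] x → z ⊏[ b ] y → z ⊏[ b ] x ⊓ y
  ⊓-glb b {x} {y} z⊏x z⊏y with <-≤-total x y
  ... | inj₁ _ = z⊏x
  ... | inj₂ _ = z⊏y

  ⊓-lb : ∀ b {x y z} → z ⊏[ b ] x ⊓ y → z ⊏[ b ] x × z ⊏[ b ] y
  ⊓-lb b {x} {y} z⊏ with <-≤-total x y
  ... | inj₁ x<y = z⊏ , ⊏-≤-trans b z⊏ (inj₁ x<y)
  ... | inj₂ y≤x = ⊏-≤-trans b z⊏ y≤x , z⊏

  ⊔-lub : ∀ b {x y z} → x ⊏[ b ] z → y ⊏[ b ] z → x ⊔ y ⊏[ b ] z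
  ⊔-lub b {x} {y} x⊏z y⊏z with <-≤-total y x
  ... | inj₁ _ = x⊏z
  ... | inj₂ _ = y⊏z

  ⊔-ub : ∀ b {x y z} → x ⊔ y ⊏[ b ] z → x ⊏[ b ] z × y ⊏[ b ] z
  ⊔-ub b {x} {y} ⊏z with <-≤-total y x
  ... | inj₁ y<x = ⊏z , ≤-⊏-trans b (inj₁ y<x) ⊏z
  ... | inj₂ x≤y = ≤-⊏-trans b x≤y ⊏z , ⊏z

  _≟_ : DecidableEquality R
  _≟_ = tri⇒dec≈ compare

  _<?_ : Decidable _<_
  _<?_ = tri⇒dec< compare


  ordered-≐⇒≢ : ∀ {u x y} → proj₁ u < proj₂ u → u ≐ (x , y) → x ≢ y
  ordered-≐⇒≢ lo<hi (inj₁ refl) = <⇒≢ lo<hi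
  ordered-≐⇒≢ lo<hi (inj₂ refl) = <⇒≢ lo<hi ∘ sym

  ordered-≐⇒≡ : ∀ {u v} → proj₁ u < proj₂ u → proj₁ v < proj₂ v → u ≐ v → u ≡ v
  ordered-≐⇒≡ _ _ (inj₁ u≡v) = u≡v
  ordered-≐⇒≡ u₁<u₂ v₁<v₂ (inj₂ refl) = ⊥-elim (<-asym u₁<u₂ v₁<v₂)

module TentMap (ℝ : RealField) (μ : RealField.R ℝ)
               (1<μ : RealField._<_ ℝ (RealField.1r ℝ) μ)
               (μ<2 : RealField._<_ ℝ μ (RealField._+_ ℝ (RealField.1r ℝ) (RealField.1r ℝ))) where
  open OrderedField ℝ
  open Tent ℝ μ public using (f; iter; step; bit; γ; T; InL; SameType)
  open ≡-Reasoning

  fₗ fᵣ : R → R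
  fₗ y = μ * y
  fᵣ y = μ * (1r - y)

  0<μ : 0r < μ
  0<μ = <-trans 0<1 1<μ

  fₗ-increasing : ∀ {x y} → x < y → fₗ x < fₗ y
  fₗ-increasing = *-monoˡ-< 0<μ

  fᵣ-decreasing : ∀ {x y} → x < y → fᵣ y < fᵣ x
  fᵣ-decreasing x<y = *-monoˡ-< 0<μ (+-monoʳ-< 1r (neg-mono-< x<y))

  μ⁻¹ : R
  μ⁻¹ = proj₁ (*-inverse μ (λ μ≡0 → <⇒≢ 0<μ (sym μ≡0)))

  fₗ-section : ∀ z → fₗ (μ⁻¹ * z) ≡ z
  fₗ-section z = begin
    μ * (μ⁻¹ * z)  ≡⟨ *-assoc μ μ⁻¹ z ⟨
    (μ * μ⁻¹) * z  ≡⟨ cong (_* z) (proj₂ (*-inverse μ _)) ⟩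
    1r * z         ≡⟨ *-identityˡ z ⟩
    z              ∎

  fᵣ-section : ∀ z → fᵣ (1r - μ⁻¹ * z) ≡ z
  fᵣ-section z = trans (cong (μ *_) (x-[x-y]≡y 1r (μ⁻¹ * z))) (fₗ-section z)

  f-left : ∀ {y} → y ≤ half → f y ≡ fₗ y
  f-left {y} y≤½ with compare y half
  ... | tri< _ _ _ = refl
  ... | tri≈ _ _ _ = refl
  ... | tri> _ _ ½<y = ⊥-elim (≤⇒≯ y≤½ ½<y)

  f-right : ∀ {y} → half ≤ y → f y ≡ fᵣ y
  f-right {y} ½≤y with compare y half
  ... | tri< y<½ _ _ = ⊥-elim (≤⇒≯ ½≤y y<½)
  ... | tri≈ _ refl _ = cong (μ *_) (sym 1-½≡½)
  ... | tri> _ _ _ = refl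

  step-stay : ∀ β {y} → y ⊏[ not β ] half → step β y ≡ β
  step-stay false {y} y<½ with compare y half
  ... | tri< _ _ _ = refl
  ... | tri≈ _ y≡½ _ = ⊥-elim (<⇒≢ y<½ y≡½)
  ... | tri> _ _ ½<y = ⊥-elim (<-asym y<½ ½<y)
  step-stay true {y} y≤½ with compare y half
  ... | tri< _ _ _ = refl
  ... | tri≈ _ _ _ = refl
  ... | tri> _ _ ½<y = ⊥-elim (≤⇒≯ y≤½ ½<y)

  step-turn : ∀ β {y} → half ⊏[ β ] y → step β y ≡ not β
  step-turn false {y} ½≤y with compare y half
  ... | tri< y<½ _ _ = ⊥-elim (≤⇒≯ ½≤y y<½)
  ... | tri≈ _ _ _ = refl
  ... | tri> _ _ _ = refl
  step-turn true {y} ½<y with compare y half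
  ... | tri< y<½ _ _ = ⊥-elim (<-asym y<½ ½<y)
  ... | tri≈ _ y≡½ _ = ⊥-elim (<⇒≢ ½<y (sym y≡½))
  ... | tri> _ _ _ = refl

  step-cases : ∀ β y → y ⊏[ not β ] half ⊎ half ⊏[ β ] y
  step-cases false y = ⊏-total true y half
  step-cases true y = ⊏-total false y half

  -- Intervals of points with a common code

  -- The tag β is the last code bit of the points the interval comes from; it fixes which
  -- end is closed: [lo, hi) if β = false, (lo, hi] if β = true.
  record Interval : Set where
    constructor interval
    field
      lo hi : R
      β : Bool
  open Interval public

  infix 4 _∋_
  _∋_ : Interval → R → Set
  interval lo hi β ∋ y = lo ⊏[ β ] y × y ⊏[ not β ] hi

  stay turn : Interval → Interval
  stay (interval lo hi β) = interval (fₗ lo) (fₗ (hi ⊓ half)) β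
  turn (interval lo hi β) = interval (fᵣ hi) (fᵣ (lo ⊔ half)) (not β)

  child : Interval → Bool → Interval
  child s b = if b xor β s then turn s else stay s

  child-β : ∀ s b → β (child s b) ≡ b
  child-β (interval _ _ false) false = refl
  child-β (interval _ _ false) true = refl
  child-β (interval _ _ true) false = refl
  child-β (interval _ _ true) true = refl

  child-stay : ∀ s → child s (β s) ≡ stay s
  child-stay (interval _ _ false) = refl
  child-stay (interval _ _ true) = refl

  child-turn : ∀ s → child s (not (β s)) ≡ turn s
  child-turn (interval _ _ false) = refl
  child-turn (interval _ _ true) = refl

  ⊏-not-not : ∀ b {x y} → x ⊏[ b ] y → x ⊏[ not (not b) ] y
  ⊏-not-not b {x} {y} = subst (λ b′ → x ⊏[ b′ ] y) (sym (not-involutive b))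

  ⊏-not-not⁻ : ∀ b {x y} → x ⊏[ not (not b) ] y → x ⊏[ b ] y
  ⊏-not-not⁻ b {x} {y} = subst (λ b′ → x ⊏[ b′ ] y) (not-involutive b)

  stay-maps : ∀ s {y} → s ∋ y → y ⊏[ not (β s) ] half → stay s ∋ f y
  stay-maps (interval lo hi β) (lo⊏y , y⊏hi) y⊏½ rewrite f-left (⊏⇒≤ (not β) y⊏½) =
    increasing-⊏ fₗ-increasing β lo⊏y ,
    increasing-⊏ fₗ-increasing (not β) (⊓-glb (not β) y⊏hi y⊏½)

  turn-maps : ∀ s {y} → s ∋ y → half ⊏[ β s ] y → turn s ∋ f y
  turn-maps (interval lo hi β) (lo⊏y , y⊏hi) ½⊏y rewrite f-right (⊏⇒≤ β ½⊏y) =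
    decreasing-⊏ fᵣ-decreasing (not β) y⊏hi ,
    ⊏-not-not β (decreasing-⊏ fᵣ-decreasing β (⊔-lub β lo⊏y ½⊏y))

  stay-preimage : ∀ s {y} → stay s ∋ fₗ y → s ∋ y × y ⊏[ not (β s) ] half
  stay-preimage (interval lo hi β) (fₗlo⊏fₗy , fₗy⊏) =
    let y⊏hi , y⊏½ = ⊓-lb (not β) (increasing-⊏⁻ fₗ-increasing (not β) fₗy⊏)
    in (increasing-⊏⁻ fₗ-increasing β fₗlo⊏fₗy , y⊏hi) , y⊏½

  turn-preimage : ∀ s {y} → turn s ∋ fᵣ y → s ∋ y × half ⊏[ β s ] y
  turn-preimage (interval lo hi β) (fᵣhi⊏fᵣy , fᵣy⊏) =
    let lo⊏y , ½⊏y = ⊔-ub β (decreasing-⊏⁻ fᵣ-decreasing β (⊏-not-not⁻ β fᵣy⊏))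
    in (lo⊏y , decreasing-⊏⁻ fᵣ-decreasing (not β) fᵣhi⊏fᵣy) , ½⊏y

  child-maps : ∀ s {y} → s ∋ y → child s (step (β s) y) ∋ f y
  child-maps s {y} s∋y with step-cases (β s) y
  ... | inj₁ y⊏½ rewrite step-stay (β s) y⊏½ | child-stay s = stay-maps s s∋y y⊏½
  ... | inj₂ ½⊏y rewrite step-turn (β s) ½⊏y | child-turn s = turn-maps s s∋y ½⊏y

  ≡-or-≡not : ∀ b b′ → b ≡ b′ ⊎ b ≡ not b′
  ≡-or-≡not false false = inj₁ refl
  ≡-or-≡not false true = inj₂ refl
  ≡-or-≡not true false = inj₂ refl
  ≡-or-≡not true true = inj₁ refl

  child-preimage : ∀ s b {z} → child s b ∋ z →
                   ∃ λ y → s ∋ y × step (β s) y ≡ b × f y ≡ z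
  child-preimage s b {z} child∋z with ≡-or-≡not b (β s)
  ... | inj₁ refl =
    let s∋y , y⊏½ = stay-preimage s (subst₂ _∋_ (child-stay s) (sym (fₗ-section z)) child∋z)
    in μ⁻¹ * z , s∋y , step-stay (β s) y⊏½ , trans (f-left (⊏⇒≤ (not (β s)) y⊏½)) (fₗ-section z)
  ... | inj₂ refl =
    let s∋y , ½⊏y = turn-preimage s (subst₂ _∋_ (child-turn s) (sym (fᵣ-section z)) child∋z)
    in 1r - μ⁻¹ * z , s∋y , step-turn (β s) ½⊏y , trans (f-right (⊏⇒≤ (β s) ½⊏y)) (fᵣ-section z)

  iter-shift : ∀ k y → iter k (f y) ≡ iter (suc k) y
  iter-shift zero y = refl
  iter-shift (suc k) y = cong f (iter-shift k y)

  codeFrom : Bool → (m : ℕ) → R → Vec Bool m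
  codeFrom β zero y = []
  codeFrom β (suc m) y = step β y ∷ codeFrom (step β y) m (f y)

  bitAfter : Bool → ℕ → R → Bool
  bitAfter β zero y = step β y
  bitAfter β (suc i) y = step (bitAfter β i y) (iter (suc i) y)

  bitAfter-shift : ∀ β i y → bitAfter β (suc i) y ≡ bitAfter (step β y) i (f y)
  bitAfter-shift β zero y = refl
  bitAfter-shift β (suc i) y = cong₂ step (bitAfter-shift β i y) (sym (iter-shift (suc i) y))

  tabulate-bitAfter : ∀ β m y → tabulate (λ (i : Fin m) → bitAfter β (toℕ i) y) ≡ codeFrom β m y
  tabulate-bitAfter β zero y = refl
  tabulate-bitAfter β (suc m) y = cong (step β y ∷_) (trans
    (tabulate-cong (λ i → bitAfter-shift β (toℕ i) y))
    (tabulate-bitAfter (step β y) m (f y)))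

  bit≡bitAfter : ∀ i x → bit i x ≡ bitAfter false i x
  bit≡bitAfter zero x with compare x half
  ... | tri< _ _ _ = refl
  ... | tri≈ _ _ _ = refl
  ... | tri> _ _ _ = refl
  bit≡bitAfter (suc i) x = cong (λ b → step b (iter (suc i) x)) (bit≡bitAfter i x)

  γ≡codeFrom : ∀ m x → γ m x ≡ codeFrom false m x
  γ≡codeFrom m x =
    trans (tabulate-cong (λ i → bit≡bitAfter (toℕ i) x)) (tabulate-bitAfter false m x)

  run : ∀ {m} → Interval → Vec Bool m → Interval
  run s [] = s
  run s (b ∷ bs) = run (child s b) bs

  run-maps : ∀ m s {y} → s ∋ y → run s (codeFrom (β s) m y) ∋ iter m y
  run-maps zero s s∋y = s∋y
  run-maps (suc m) s {y} s∋y =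
    subst₂ _∋_ (cong (λ b → run s′ (codeFrom b m (f y))) (child-β s b)) (iter-shift m y)
      (run-maps m s′ (child-maps s s∋y))
    where
    b = step (β s) y
    s′ = child s b

  run-preimage : ∀ {m} s (c : Vec Bool m) {z} → run s c ∋ z →
                 ∃ λ y → s ∋ y × codeFrom (β s) m y ≡ c × iter m y ≡ z
  run-preimage s [] {z} s∋z = z , s∋z , refl , refl
  run-preimage {suc m} s (b ∷ bs) run∋z with run-preimage (child s b) bs run∋z
  ... | y₁ , child∋y₁ , code≡bs , iter≡z with child-preimage s b child∋y₁
  ...   | y , s∋y , step≡b , fy≡y₁ =
    y , s∋y ,
    cong₂ _∷_ step≡b
      (trans (cong₂ (λ b′ w → codeFrom b′ m w) (trans step≡b (sym (child-β s b))) fy≡y₁) code≡bs) ,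
    trans (sym (iter-shift m y)) (trans (cong (iter m) fy≡y₁) iter≡z)

  unit : Interval
  unit = interval 0r 1r false

  T⇒run : ∀ m (c : Vec Bool m) {y} → T m c y → run unit c ∋ y
  T⇒run m c (x , (x∈unit , γx≡c) , iter≡y) =
    subst₂ _∋_ (cong (run unit) (trans (sym (γ≡codeFrom m x)) γx≡c)) iter≡y (run-maps m unit x∈unit)

  run⇒T : ∀ m (c : Vec Bool m) {y} → run unit c ∋ y → T m c y
  run⇒T m c run∋y with run-preimage unit c run∋y
  ... | x , x∈unit , code≡c , iter≡y = x , (x∈unit , trans (γ≡codeFrom m x) code≡c) , iter≡y

  run≡⇒SameType : ∀ m (c c′ : Vec Bool m) → run unit c ≡ run unit c′ → SameType m c c′
  run≡⇒SameType m c c′ eq y =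
    (λ t → run⇒T m c′ (subst (_∋ y) eq (T⇒run m c t))) ,
    (λ t → run⇒T m c (subst (_∋ y) (sym eq) (T⇒run m c′ t)))

  run∋⇒InL : ∀ m (c : Vec Bool m) {y} → run unit c ∋ y → InL m c
  run∋⇒InL m c run∋y = let x , Sx , _ = run⇒T m c run∋y in x , Sx

  -- The Hofbauer tower

  c : ℕ → R
  c k = iter k half

  c₁≡fₗ½ : c 1 ≡ fₗ half
  c₁≡fₗ½ = f-left ≤-refl

  c₁≡fᵣ½ : c 1 ≡ fᵣ half
  c₁≡fᵣ½ = f-right ≤-refl

  Straddles : R → R → Set
  Straddles a b = (a < half × half < b) ⊎ (b < half × half < a)

  straddles? : ∀ a b → Dec (Straddles a b)
  straddles? a b = (a <? half ×-dec half <? b) ⊎-dec (b <? half ×-dec half <? a)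

  SameSide : R → R → Set
  SameSide a b = (a ≤ half × b ≤ half) ⊎ (half ≤ a × half ≤ b)

  p : ℕ → R
  p zero = 0r
  p (suc k) with straddles? (c k) (p k)
  ... | yes _ = c 1
  ... | no _ = f (p k)

  p-straddle : ∀ {k} → Straddles (c k) (p k) → p (suc k) ≡ c 1
  p-straddle {k} st with straddles? (c k) (p k)
  ... | yes _ = refl
  ... | no ¬st = ⊥-elim (¬st st)

  p-no-straddle : ∀ {k} → ¬ Straddles (c k) (p k) → p (suc k) ≡ f (p k)
  p-no-straddle {k} ¬st with straddles? (c k) (p k)
  ... | yes st = ⊥-elim (¬st st)
  ... | no _ = refl

  ¬straddles-half : ∀ {x} → ¬ Straddles half x
  ¬straddles-half (inj₁ (½<½ , _)) = <-irrefl ½<½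
  ¬straddles-half (inj₂ (_ , ½<½)) = <-irrefl ½<½

  fᵣ1≡0 : fᵣ 1r ≡ 0r
  fᵣ1≡0 = trans (cong (μ *_) (-‿inverseʳ 1r)) (zeroʳ μ)

  f0≡0 : f 0r ≡ 0r
  f0≡0 = trans (f-left (inj₁ 0<½)) (zeroʳ μ)

  f1≡0 : f 1r ≡ 0r
  f1≡0 = trans (f-right (inj₁ ½<1)) fᵣ1≡0

  p₁≡0 : p 1 ≡ 0r
  p₁≡0 = trans (p-no-straddle ¬straddles-half) f0≡0

  ¬straddles⇒sameSide : ∀ {a b} → ¬ Straddles a b → SameSide a b
  ¬straddles⇒sameSide {a} {b} ¬st with compare a half
  ... | tri< a<½ _ _ with <-≤-total half b
  ...   | inj₁ ½<b = ⊥-elim (¬st (inj₁ (a<½ , ½<b)))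
  ...   | inj₂ b≤½ = inj₁ (inj₁ a<½ , b≤½)
  ¬straddles⇒sameSide {a} {b} ¬st | tri≈ _ a≡½ _ with <-≤-total b half
  ...   | inj₁ b<½ = inj₁ (inj₂ a≡½ , inj₁ b<½)
  ...   | inj₂ ½≤b = inj₂ (inj₂ (sym a≡½) , ½≤b)
  ¬straddles⇒sameSide {a} {b} ¬st | tri> _ _ ½<a with <-≤-total b half
  ...   | inj₁ b<½ = ⊥-elim (¬st (inj₂ (b<½ , ½<a)))
  ...   | inj₂ ½≤b = inj₂ (inj₁ ½<a , ½≤b)

  sameSide-half : ∀ a → SameSide a half
  sameSide-half a with <-≤-total half a
  ... | inj₁ ½<a = inj₂ (inj₁ ½<a , ≤-refl)
  ... | inj₂ a≤½ = inj₁ (a≤½ , ≤-refl)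

  f-hull : ∀ {a b y} → SameSide a b → y ∈ Hull a b → f y ∈ Hull (f a) (f b)
  f-hull (inj₁ (a≤½ , b≤½)) y∈
    rewrite f-left a≤½ | f-left b≤½ | f-left (hull-bounded y∈ a≤½ b≤½) =
    increasing-hull fₗ-increasing y∈
  f-hull (inj₂ (½≤a , ½≤b)) y∈
    rewrite f-right ½≤a | f-right ½≤b | f-right (hull-bounded⁻ y∈ ½≤a ½≤b) =
    decreasing-hull fᵣ-decreasing y∈

  hull-toward-half : ∀ {a q x} → Straddles a q → x ∈ Hull a q → SameSide x a → x ∈ Hull a half
  hull-toward-half (inj₁ (a<½ , _)) _ (inj₂ (_ , ½≤a)) = ⊥-elim (≤⇒≯ ½≤a a<½)
  hull-toward-half (inj₁ _) (inj₁ (a≤x , _)) (inj₁ (x≤½ , _)) = inj₁ (a≤x , x≤½)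
  hull-toward-half (inj₁ (a<½ , ½<q)) (inj₂ (q≤x , x≤a)) (inj₁ _) =
    ⊥-elim (≤⇒≯ (≤-trans q≤x x≤a) (<-trans a<½ ½<q))
  hull-toward-half (inj₂ (_ , ½<a)) _ (inj₁ (_ , a≤½)) = ⊥-elim (≤⇒≯ a≤½ ½<a)
  hull-toward-half (inj₂ (q<½ , ½<a)) (inj₁ (a≤x , x≤q)) (inj₂ _) =
    ⊥-elim (≤⇒≯ (≤-trans a≤x x≤q) (<-trans q<½ ½<a))
  hull-toward-half (inj₂ _) (inj₂ (_ , x≤a)) (inj₂ (½≤x , _)) = inj₂ (½≤x , x≤a)

  hull-straddles : ∀ {x a q} → Straddles x a → x ∈ Hull a q → Straddles a q
  hull-straddles (inj₁ (x<½ , ½<a)) (inj₁ (a≤x , _)) = ⊥-elim (≤⇒≯ a≤x (<-trans x<½ ½<a))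
  hull-straddles (inj₁ (x<½ , ½<a)) (inj₂ (q≤x , _)) = inj₂ (≤-<-trans q≤x x<½ , ½<a)
  hull-straddles (inj₂ (a<½ , ½<x)) (inj₁ (_ , x≤q)) = inj₁ (a<½ , <-≤-trans ½<x x≤q)
  hull-straddles (inj₂ (a<½ , ½<x)) (inj₂ (_ , x≤a)) = ⊥-elim (≤⇒≯ x≤a (<-trans a<½ ½<x))

  half-in-hull : ∀ {a q} → half ∈ Hull a q → ¬ Straddles a q → half ≡ a ⊎ half ≡ q
  half-in-hull (inj₁ (inj₂ a≡½ , _)) _ = inj₁ (sym a≡½)
  half-in-hull (inj₁ (inj₁ _ , inj₂ ½≡q)) _ = inj₂ ½≡q
  half-in-hull (inj₁ (inj₁ a<½ , inj₁ ½<q)) ¬st = ⊥-elim (¬st (inj₁ (a<½ , ½<q)))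
  half-in-hull (inj₂ (inj₂ q≡½ , _)) _ = inj₂ (sym q≡½)
  half-in-hull (inj₂ (inj₁ _ , inj₂ ½≡a)) _ = inj₁ ½≡a
  half-in-hull (inj₂ (inj₁ q<½ , inj₁ ½<a)) ¬st = ⊥-elim (¬st (inj₂ (q<½ , ½<a)))

  c₁<1 : c 1 < 1r
  c₁<1 = subst₂ _<_ (trans (*-comm half μ) (sym c₁≡fₗ½)) ½[1+1]≡1 (*-monoˡ-< 0<½ μ<2)
    where
    ½[1+1]≡1 : half * (1r + 1r) ≡ 1r
    ½[1+1]≡1 = begin
      half * (1r + 1r)        ≡⟨ distribˡ half 1r 1r ⟩
      half * 1r + half * 1r   ≡⟨ cong₂ _+_ (*-identityʳ half) (*-identityʳ half) ⟩
      half + half             ≡⟨ half-def ⟩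
      1r                      ∎

  f-range : ∀ {y} → 0r ≤ y → y ≤ 1r → 0r ≤ f y × f y ≤ c 1
  f-range {y} 0≤y y≤1 with <-≤-total half y
  ... | inj₂ y≤½ rewrite f-left y≤½ | c₁≡fₗ½ =
    subst (_≤ fₗ y) (zeroʳ μ) (increasing-⊏ fₗ-increasing false 0≤y) ,
    increasing-⊏ fₗ-increasing false y≤½
  ... | inj₁ ½<y rewrite f-right (inj₁ ½<y) | c₁≡fᵣ½ =
    subst (_≤ fᵣ y) fᵣ1≡0 (decreasing-⊏ fᵣ-decreasing false y≤1) ,
    decreasing-⊏ fᵣ-decreasing false (inj₁ ½<y)

  c-range : ∀ k → 0r ≤ c (suc k) × c (suc k) ≤ c 1
  c-range zero = f-range (inj₁ 0<½) (inj₁ ½<1)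
  c-range (suc k) = let 0≤c , c≤c₁ = c-range k in f-range 0≤c (≤-trans c≤c₁ (inj₁ c₁<1))

  in-level₁ : ∀ {y} → 0r ≤ y → y ≤ c 1 → y ∈ Hull (c 1) (p 1)
  in-level₁ 0≤y y≤c₁ = inj₂ (subst (_≤ _) (sym p₁≡0) 0≤y , y≤c₁)

  image-in-next-level : ∀ {x j} → ¬ Straddles x (c j) → x ∈ Hull (c j) (p j) →
                        f x ∈ Hull (c (suc j)) (p (suc j))
  image-in-next-level {x} {j} ¬st x∈ with straddles? (c j) (p j)
  ... | yes st = f-hull (sameSide-half (c j)) (hull-toward-half st x∈ (¬straddles⇒sameSide ¬st))
  ... | no ¬st′ = f-hull (¬straddles⇒sameSide ¬st′) x∈

  Anchored : ℕ → Set
  Anchored k = p k ≡ 0r ⊎ ∃ λ j → j ℕ.< k × p k ≡ c j × Hull (c k) (p k) ⊆ Hull (c j) (p j)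

  anchored-step : ∀ k → 1 ℕ.≤ k → Anchored k → Anchored (suc k)
  anchored-step k 1≤k anch with straddles? (c k) (p k) | anch
  ... | yes _ | _ = inj₂ (1 , s≤s 1≤k , refl ,
    hull-convex (uncurry in-level₁ (c-range k)) (in-level₁ (proj₁ (c-range 0)) ≤-refl))
  ... | no _ | inj₁ pₖ≡0 = inj₁ (trans (cong f pₖ≡0) f0≡0)
  ... | no ¬st | inj₂ (j , j<k , pₖ≡cⱼ , levelₖ⊆levelⱼ) =
    inj₂ (suc j , s≤s j<k , cong f pₖ≡cⱼ , hull-convex fcₖ∈ fpₖ∈)
    where
    fcₖ∈ : f (c k) ∈ Hull (c (suc j)) (p (suc j))
    fcₖ∈ = image-in-next-level (subst (¬_ ∘ Straddles (c k)) pₖ≡cⱼ ¬st)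
                               (levelₖ⊆levelⱼ (hull-left _ _))
    fpₖ∈ : f (p k) ∈ Hull (c (suc j)) (p (suc j))
    fpₖ∈ = subst (λ x → f x ∈ Hull (c (suc j)) (p (suc j))) (sym pₖ≡cⱼ) (hull-left _ _)

  anchored : ∀ k → 1 ℕ.≤ k → Anchored k
  anchored (suc zero) _ = inj₁ p₁≡0
  anchored (suc (suc k)) _ = anchored-step (suc k) (s≤s z≤n) (anchored (suc k) (s≤s z≤n))

  straddle-return : ∀ {k} → 1 ℕ.≤ k → Straddles (c k) (p k) →
                    ∃ λ j → 1 ℕ.≤ j × j ℕ.≤ k × (c 1 , f (p k)) ≐ (c j , p j)
  straddle-return {k} 1≤k st with anchored k 1≤k
  ... | inj₁ pₖ≡0 =
    1 , s≤s z≤n , 1≤k , inj₁ (cong (c 1 ,_) (trans (cong f pₖ≡0) (trans f0≡0 (sym p₁≡0))))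
  ... | inj₂ (j , j<k , pₖ≡cⱼ , levelₖ⊆levelⱼ) =
    suc j , s≤s z≤n , j<k , inj₂ (cong₂ _,_ (sym (p-straddle stⱼ)) (cong f pₖ≡cⱼ))
    where
    stⱼ : Straddles (c j) (p j)
    stⱼ = hull-straddles (subst (Straddles (c k)) pₖ≡cⱼ st) (levelₖ⊆levelⱼ (hull-left _ _))

  period-return : ∀ {n} → 1 ℕ.≤ n → c n ≡ half → c n ≢ p n →
                  ∃ λ j → 1 ℕ.≤ j × j ℕ.≤ n × (f (c n) , f (p n)) ≐ (c j , p j)
  period-return {n} 1≤n cₙ≡½ cₙ≢pₙ with anchored n 1≤n
  ... | inj₁ pₙ≡0 =
    1 , s≤s z≤n , 1≤n , inj₁ (cong₂ _,_ (cong f cₙ≡½) (trans (cong f pₙ≡0) (trans f0≡0 (sym p₁≡0))))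
  ... | inj₂ (j , j<n , pₙ≡cⱼ , levelₙ⊆levelⱼ) with straddles? (c j) (p j)
  ...   | yes stⱼ = suc j , s≤s z≤n , j<n ,
            inj₂ (cong₂ _,_ (trans (cong f cₙ≡½) (sym (p-straddle stⱼ))) (cong f pₙ≡cⱼ))
  ...   | no ¬stⱼ
          with half-in-hull (subst (_∈ Hull (c j) (p j)) cₙ≡½ (levelₙ⊆levelⱼ (hull-left _ _))) ¬stⱼ
  ...     | inj₁ ½≡cⱼ = ⊥-elim (cₙ≢pₙ (trans cₙ≡½ (trans ½≡cⱼ (sym pₙ≡cⱼ))))
  ...     | inj₂ ½≡pⱼ = suc j , s≤s z≤n , j<n ,
            inj₂ (cong₂ _,_ (trans (cong f (trans cₙ≡½ ½≡pⱼ)) (sym (p-no-straddle ¬stⱼ)))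
                            (cong f pₙ≡cⱼ))

  -- Children of the levels of the tower

  ends : Interval → R × R
  ends s = lo s , hi s

  ∋⇒lo<hi : ∀ s {y} → s ∋ y → lo s < hi s
  ∋⇒lo<hi (interval _ _ β) (lo⊏y , y⊏hi) = ⊏-either-strict β lo⊏y y⊏hi

  interval-inhabited : ∀ s → lo s < hi s → ∃ (s ∋_)
  interval-inhabited (interval lo hi false) lo<hi = lo , ≤-refl , lo<hi
  interval-inhabited (interval lo hi true) lo<hi = hi , lo<hi , ≤-refl

  stay-inhabited : ∀ s {z} → stay s ∋ z → lo s < half
  stay-inhabited s {z} stay∋z =
    let (lo⊏y , _) , y⊏½ = stay-preimage s (subst (stay s ∋_) (sym (fₗ-section z)) stay∋z)
    in ⊏-either-strict (β s) lo⊏y y⊏½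

  turn-inhabited : ∀ s {z} → turn s ∋ z → half < hi s
  turn-inhabited s {z} turn∋z =
    let (_ , y⊏hi) , ½⊏y = turn-preimage s (subst (turn s ∋_) (sym (fᵣ-section z)) turn∋z)
    in ⊏-either-strict (β s) ½⊏y y⊏hi

  -- The possible ends of a nonempty child of an interval with ends a and b.
  ChildEnds : R → R → R × R → Set
  ChildEnds a b e = (¬ Straddles a b × e ≐ (f a , f b)) ⊎
                    (Straddles a b × (e ≐ (f a , c 1) ⊎ e ≐ (f b , c 1)))

  straddles-swap : ∀ {a b} → Straddles a b → Straddles b a
  straddles-swap (inj₁ st) = inj₂ st
  straddles-swap (inj₂ st) = inj₁ st

  childEnds-resp : ∀ {a b a′ b′ e} → (a , b) ≐ (a′ , b′) → ChildEnds a b e → ChildEnds a′ b′ e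
  childEnds-resp (inj₁ refl) childEnds = childEnds
  childEnds-resp (inj₂ refl) (inj₁ (¬st , e≐)) = inj₁ (¬st ∘ straddles-swap , ≐-swap e≐)
  childEnds-resp (inj₂ refl) (inj₂ (st , e≐)) = inj₂ (straddles-swap st , Sum.swap e≐)

  stay-ends : ∀ s → lo s < half → ChildEnds (lo s) (hi s) (ends (stay s))
  stay-ends (interval lo hi β) lo<½ with <-≤-total half hi
  ... | inj₁ ½<hi = inj₂ (inj₁ (lo<½ , ½<hi) , inj₁ (inj₁ (cong₂ _,_
          (sym (f-left (inj₁ lo<½))) (trans (cong fₗ (y≤x⇒x⊓y≡y (inj₁ ½<hi))) (sym c₁≡fₗ½)))))
  ... | inj₂ hi≤½ = inj₁ (¬st , inj₁ (cong₂ _,_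
          (sym (f-left (inj₁ lo<½))) (trans (cong fₗ (x≤y⇒x⊓y≡x hi≤½)) (sym (f-left hi≤½)))))
    where
    ¬st : ¬ Straddles lo hi
    ¬st (inj₁ (_ , ½<hi)) = ≤⇒≯ hi≤½ ½<hi
    ¬st (inj₂ (_ , ½<lo)) = <-asym lo<½ ½<lo

  turn-ends : ∀ s → half < hi s → ChildEnds (lo s) (hi s) (ends (turn s))
  turn-ends (interval lo hi β) ½<hi with <-≤-total lo half
  ... | inj₁ lo<½ = inj₂ (inj₁ (lo<½ , ½<hi) , inj₂ (inj₁ (cong₂ _,_
          (sym (f-right (inj₁ ½<hi))) (trans (cong fᵣ (x≤y⇒x⊔y≡y (inj₁ lo<½))) (sym c₁≡fᵣ½)))))
  ... | inj₂ ½≤lo = inj₁ (¬st , inj₂ (cong₂ _,_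
          (sym (f-right (inj₁ ½<hi))) (trans (cong fᵣ (y≤x⇒x⊔y≡x ½≤lo)) (sym (f-right ½≤lo)))))
    where
    ¬st : ¬ Straddles lo hi
    ¬st (inj₁ (lo<½ , _)) = ≤⇒≯ ½≤lo lo<½
    ¬st (inj₂ (hi<½ , _)) = <-asym hi<½ ½<hi

  child-ends : ∀ s b {z} → child s b ∋ z → ChildEnds (lo s) (hi s) (ends (child s b))
  child-ends s b child∋z with ≡-or-≡not b (β s)
  ... | inj₁ refl rewrite child-stay s = stay-ends s (stay-inhabited s child∋z)
  ... | inj₂ refl rewrite child-turn s = turn-ends s (turn-inhabited s child∋z)


  AtLevel : ℕ → Interval → Set
  AtLevel k s = lo s < hi s × ends s ≐ (c k , p k)

  atLevel-unique : ∀ {k s s′} → AtLevel k s → AtLevel k s′ → β s ≡ β s′ → s ≡ s′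
  atLevel-unique {s = interval _ _ _} {s′ = interval _ _ _} (lo<hi , e≐) (lo<hi′ , e≐′) refl
    with ordered-≐⇒≡ lo<hi lo<hi′ (≐-trans e≐ (≐-sym e≐′))
  ... | refl = refl

module PeriodicTent (ℝ : RealField) (μ : RealField.R ℝ)
                    (1<μ : RealField._<_ ℝ (RealField.1r ℝ) μ)
                    (μ<2 : RealField._<_ ℝ μ (RealField._+_ ℝ (RealField.1r ℝ) (RealField.1r ℝ)))
                    (n : ℕ) (1≤n : 1 ℕ.≤ n)
                    (cₙ≡½ : Tent.iter ℝ μ n (RealField.half ℝ) ≡ RealField.half ℝ) where
  open OrderedField ℝ
  open TentMap ℝ μ 1<μ μ<2
  open Tent ℝ μ using (CardTypes≤)

  OnTower : Interval → Set
  OnTower s = ∃ λ k → 1 ℕ.≤ k × k ℕ.≤ n × AtLevel k s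

  tower-step : ∀ {k e} → 1 ℕ.≤ k → k ℕ.≤ n → c k ≢ p k → ChildEnds (c k) (p k) e →
               ∃ λ j → 1 ℕ.≤ j × j ℕ.≤ n × e ≐ (c j , p j)
  tower-step {k} 1≤k k≤n cₖ≢pₖ childEnds with ℕₚ.m≤n⇒m<n∨m≡n k≤n | childEnds
  ... | inj₁ k<n | inj₁ (¬st , e≐) =
    suc k , s≤s z≤n , k<n , ≐-trans e≐ (inj₁ (cong (f (c k) ,_) (sym (p-no-straddle ¬st))))
  ... | inj₂ refl | inj₁ (_ , e≐) =
    let j , 1≤j , j≤n , r = period-return 1≤k cₙ≡½ cₖ≢pₖ in j , 1≤j , j≤n , ≐-trans e≐ r
  ... | inj₂ refl | inj₂ (st , _) =
    ⊥-elim (¬straddles-half (subst (λ x → Straddles x (p n)) cₙ≡½ st))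
  ... | inj₁ k<n | inj₂ (st , inj₁ e≐) =
    suc k , s≤s z≤n , k<n , ≐-trans e≐ (inj₁ (cong (f (c k) ,_) (sym (p-straddle st))))
  ... | inj₁ k<n | inj₂ (st , inj₂ e≐) =
    let j , 1≤j , j≤k , r = straddle-return 1≤k st
    in j , 1≤j , ℕₚ.≤-trans j≤k k≤n , ≐-trans e≐ (≐-trans (inj₂ refl) r)

  child-onTower : ∀ s b {z} → OnTower s → child s b ∋ z → OnTower (child s b)
  child-onTower s b (k , 1≤k , k≤n , lo<hi , ends≐) child∋z =
    let j , 1≤j , j≤n , e≐ = tower-step 1≤k k≤n (ordered-≐⇒≢ lo<hi ends≐)
                                         (childEnds-resp ends≐ (child-ends s b child∋z))
    in j , 1≤j , j≤n , ∋⇒lo<hi (child s b) child∋z , e≐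

  unit-child-onTower : ∀ b {z} → child unit b ∋ z → OnTower (child unit b)
  unit-child-onTower b child∋z =
    1 , s≤s z≤n , 1≤n , ∋⇒lo<hi (child unit b) child∋z , ends≐ (child-ends unit b child∋z)
    where
    ends≐ : ∀ {e} → ChildEnds 0r 1r e → e ≐ (c 1 , p 1)
    ends≐ (inj₁ (¬st , _)) = ⊥-elim (¬st (inj₁ (0<½ , ½<1)))
    ends≐ (inj₂ (_ , inj₁ e≐)) = ≐-trans e≐ (inj₂ (cong (_, c 1) (trans f0≡0 (sym p₁≡0))))
    ends≐ (inj₂ (_ , inj₂ e≐)) = ≐-trans e≐ (inj₂ (cong (_, c 1) (trans f1≡0 (sym p₁≡0))))

  run-onTower : ∀ {m} s → (∀ {y} → s ∋ y → OnTower s) →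
                (bs : Vec Bool m) → ∀ {z} → run s bs ∋ z → OnTower (run s bs)
  run-onTower s inhabited⇒onTower [] s∋z = inhabited⇒onTower s∋z
  run-onTower s inhabited⇒onTower (b ∷ bs) = run-onTower (child s b) child-inhabited⇒onTower bs
    where
    child-inhabited⇒onTower : ∀ {y} → child s b ∋ y → OnTower (child s b)
    child-inhabited⇒onTower child∋y =
      let _ , s∋x , _ = child-preimage s b child∋y
      in child-onTower s b (inhabited⇒onTower s∋x) child∋y

  code-onTower : ∀ {m} (bs : Vec Bool (suc m)) {z} → run unit bs ∋ z → OnTower (run unit bs)
  code-onTower (b ∷ bs) = run-onTower (child unit b) (unit-child-onTower b) bs

  Realises : ∀ {m} → ℕ × Bool → Vec Bool m → Set
  Realises (k , b) bs = AtLevel k (run unit bs) × β (run unit bs) ≡ b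

  realises? : ∀ {m} kb (bs : Vec Bool m) → Dec (Realises kb bs)
  realises? (k , b) bs =
    (lo s <? hi s ×-dec ≐-dec _≟_ (ends s) (c k , p k)) ×-dec (β s Bool.≟ b)
    where s = run unit bs

  realises-unique : ∀ {m} kb {bs bs′ : Vec Bool m} → Realises kb bs → Realises kb bs′ →
                    run unit bs ≡ run unit bs′
  realises-unique (k , b) (atₖ , β≡b) (atₖ′ , β′≡b) =
    atLevel-unique {k} atₖ atₖ′ (trans β≡b (sym β′≡b))

  witness : ∀ m → ℕ × Bool → Maybe (Vec Bool m)
  witness m kb with any? (realises? kb) (allVecs m)
  ... | yes r = just (proj₁ (satisfied r))
  ... | no _ = nothing

  witness-InL : ∀ m kb → Maybe.All (InL m) (witness m kb)
  witness-InL m kb with any? (realises? kb) (allVecs m)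
  ... | yes r = let v , realises = satisfied r
                    lo<hi = proj₁ (proj₁ realises)
                in Maybe.just (run∋⇒InL m v (proj₂ (interval-inhabited (run unit v) lo<hi)))
  ... | no _ = Maybe.nothing

  witness-complete : ∀ {m kb} (bs : Vec Bool m) → Realises kb bs →
                     Maybe.Any (λ v → run unit v ≡ run unit bs) (witness m kb)
  witness-complete {m} {kb} bs realises with any? (realises? kb) (allVecs m)
  ... | yes r = let v , realises-v = satisfied r
                in Maybe.just (realises-unique kb {v} {bs} realises-v realises)
  ... | no ¬r = ⊥-elim (¬r (lose (∈-allVecs bs) realises))

  cardTypes≤2n : ∀ m → CardTypes≤ (suc m) (2 ℕ.* n)
  cardTypes≤2n m = codes , length≤ , all-InL , covers
    where
    codes : List (Vec Bool (suc m))
    codes = List.mapMaybe (witness (suc m)) (levelsAndBits n)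
    length≤ : length codes ℕ.≤ 2 ℕ.* n
    length≤ = ℕₚ.≤-trans (length-mapMaybe (witness (suc m)) (levelsAndBits n))
                         (ℕₚ.≤-reflexive (length-levelsAndBits n))
    all-InL : All.All (InL (suc m)) codes
    all-InL = Allₚ.mapMaybe⁺ (Allₚ.map⁺ (All.universal (witness-InL (suc m)) (levelsAndBits n)))
    covers : ∀ bs → InL (suc m) bs → Any (SameType (suc m) bs) codes
    covers bs (x , Sx) =
      let k , 1≤k , k≤n , atₖ = code-onTower bs (T⇒run (suc m) bs (x , Sx , refl))
          kb∈ = ∈-levelsAndBits (β (run unit bs)) 1≤k k≤n
      in Any.map (λ {v} run≡ → run≡⇒SameType (suc m) bs v (sym run≡))
           (Anyₚ.mapMaybe⁺ (witness (suc m)) (levelsAndBits n)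
             (Anyₚ.map⁺ (lose kb∈ (witness-complete bs (atₖ , refl)))))

open import Data.Nat using (_≤_; _*_)

-- The hypothesis n ≤ n′ only serves to exclude n′ = 0.
proposition4 : (ℝ : RealField) (μ : RealField.R ℝ) →
    RealField._<_ ℝ (RealField.1r ℝ) μ →
    RealField._<_ ℝ μ (RealField._+_ ℝ (RealField.1r ℝ) (RealField.1r ℝ)) →
    (n : ℕ) → 1 ≤ n →
    Tent.iter ℝ μ n (RealField.half ℝ) ≡ RealField.half ℝ →
    (n′ : ℕ) → n ≤ n′ → Tent.CardTypes≤ ℝ μ n′ (2 * n)
proposition4 ℝ μ 1<μ μ<2 n 1≤n cₙ≡½ zero n≤0 with ℕₚ.≤-trans 1≤n n≤0
... | ()
proposition4 ℝ μ 1<μ μ<2 n 1≤n cₙ≡½ (suc m) _ = PeriodicTent.cardTypes≤2n ℝ μ 1<μ μ<2 n 1≤n cₙ≡½ m
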